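{- Let $\pi$ be a permutation of $[n]$ and define $\rho^*:[n]\to\mathbb{N}$ by $$\rho^*(s)=1+\sum_{s'=1}^{s-1}[\pi(s'+1)>\pi(s')]\qquad(s\in[n]).$$ Then $\rho^*$ is a minimal sort of $\pi$ on stacks: $\rho^*$ sorts $\pi$ on stacks, and the number of piles it uses is the minimum number of piles used by any pile assignment function that sorts $\pi$ on stacks.
   Context: A deck of cards labelled by $[n]$ is represented by a permutation $\pi$ of $[n]$ with $\pi(s)$ the position (from the top) of label $s$. The stack shuffle of $\pi$ with pile assignments $\rho:[n]\to\mathbb{N}$ (label $s$ goes to the $\rho(s)$-th pile collected) is the unique permutation $\sigma$ of $[n]$ with $\sigma(s)<\sigma(t)$ iff $(\rho(s),-\pi(s))<(\rho(t),-\pi(t))$ lexicographically; $\rho$ sorts $\pi$ on stacks if $\sigma$ is the identity. The number of piles used by $\rho$ is the number of distinct values of $\rho$. $[P]$ is the indicator of $P$. -}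

module Defs where

open import Data.Nat using (ℕ; zero; suc; _+_; _<_; _≤_)
import Data.Nat as ℕ
open import Data.Fin using (Fin; zero; suc; toℕ)
import Data.Fin as F
open import Data.Fin.Permutation using (Permutation′; _⟨$⟩ʳ_)
import Data.Fin.Permutation as P
open import Data.List using (List; length; map; deduplicate)
open import Data.List.Base using (allFin)
open import Data.Product using (_×_)
open import Data.Sum using (_⊎_)
open import Relation.Binary.PropositionalEquality using (_≡_)
open import Relation.Nullary.Decidable using (⌊_⌋)
open import Data.Bool using (if_then_else_)
open import Function.Bundles using (_⇔_)

-- Labels and positions are Fin n (0-indexed versions of [n]).
-- π ⟨$⟩ʳ s is the position of label s.

LexKeyLt : ∀ {n} → Permutation′ n → (Fin n → ℕ) → Fin n → Fin n → Set
LexKeyLt π ρ s t = ρ s < ρ t ⊎ (ρ s ≡ ρ t × toℕ (π ⟨$⟩ʳ t) < toℕ (π ⟨$⟩ʳ s))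

IsStackShuffle : ∀ {n} → Permutation′ n → (Fin n → ℕ) → Permutation′ n → Set
IsStackShuffle π ρ σ =
  ∀ s t → (toℕ (σ ⟨$⟩ʳ s) < toℕ (σ ⟨$⟩ʳ t)) ⇔ LexKeyLt π ρ s t

SortsOnStacks : ∀ {n} → Permutation′ n → (Fin n → ℕ) → Set
SortsOnStacks π ρ = IsStackShuffle π ρ P.id

numPiles : ∀ {n} → (Fin n → ℕ) → ℕ
numPiles {n} ρ = length (deduplicate ℕ._≟_ (map ρ (allFin n)))

ascent : ∀ {k} → Fin k → Fin k → ℕ
ascent a b = if ⌊ toℕ a ℕ.<? toℕ b ⌋ then 1 else 0

-- ρ*(s) = 1 + Σ_{s'=1}^{s-1} [f(s'+1) > f(s')]  (1-indexed), computed by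
-- recursion: ρ*_f(s+1) = [f(2) > f(1)] + ρ*_{f ∘ suc}(s).
rhoStarFun : ∀ {m k} → (Fin m → Fin k) → Fin m → ℕ
rhoStarFun {suc m} f zero = 1
rhoStarFun {suc (suc m)} f (suc i) =
  ascent (f zero) (f (suc zero)) + rhoStarFun (λ j → f (suc j)) i

rhoStar : ∀ {n} → Permutation′ n → Fin n → ℕ
rhoStar π = rhoStarFun (π ⟨$⟩ʳ_)

{-# OPTIONS --safe #-}
-- A pile assignment ρ sorts π on stacks exactly when the key s ↦ (ρ(s), −π(s)) is strictly
-- increasing in the label s. The function ρ* has this property because it increases by one
-- precisely at the ascents π(s) < π(s+1), where the key would otherwise go down. Conversely a
-- sorting ρ must step up at every ascent, so ρ(s) = ρ(t) forces the absence of ascents between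
-- s and t, i.e. ρ*(s) = ρ*(t). Thus ρ* factors through ρ and uses at most as many piles.
module Submission where

open import Defs
open import Data.Nat as ℕ using (ℕ; zero; suc; _+_; _≤_; _<_; z≤n; s≤s)
import Data.Nat.Properties as ℕ
open import Data.Fin as F using (Fin; zero; suc; toℕ)
import Data.Fin.Properties as F
open import Data.Fin.Permutation using (Permutation′; _⟨$⟩ʳ_)
open import Data.List using (List; []; _∷_; length; map; deduplicate; allFin)
open import Data.List.Properties using (length-map; map-∘; map-cong; length-removeAt′)
open import Data.List.Membership.Propositional using (_∈_)
open import Data.List.Membership.Propositional.Properties
  using (∈-deduplicate⁻; ∈-deduplicate⁺; ∈-map⁺; ∈-map⁻)
open import Data.List.Relation.Binary.Subset.Propositional using (_⊆_)
open import Data.List.Relation.Unary.Any using (here; there; _─_; index)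
import Data.List.Relation.Unary.All as All
open import Data.List.Relation.Unary.AllPairs using (_∷_)
open import Data.List.Relation.Unary.Unique.Propositional using (Unique)
open import Data.List.Relation.Unary.Unique.DecPropositional.Properties ℕ._≟_
  using (deduplicate-!)
open import Data.Product using (_×_; _,_)
open import Data.Product.Relation.Binary.Lex.Strict using (×-asymmetric)
open import Data.Sum using (_⊎_; inj₁; inj₂)
open import Function using (_∘_)
open import Function.Bundles using (mk⇔; Injection; Equivalence)
open import Function.Definitions using (Injective)
open import Function.Properties.Inverse using (↔⇒↣)
open import Relation.Binary.Definitions using (tri<; tri≈; tri>)
open import Relation.Binary.PropositionalEquality using (_≡_; _≢_; refl; sym; trans; cong; subst)
open import Relation.Nullary using (¬_; yes; no; contradiction)

private
  variable
    A : Set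
    m k n : ℕ

∈-─⁺ : {x y : A} {ys : List A} (x∈ys : x ∈ ys) → y ∈ ys → y ≢ x → y ∈ (ys ─ x∈ys)
∈-─⁺ (here x≡z)   (here y≡z)   y≢x = contradiction (trans y≡z (sym x≡z)) y≢x
∈-─⁺ (here _)     (there y∈ys) _   = y∈ys
∈-─⁺ (there _)    (here y≡z)   _   = here y≡z
∈-─⁺ (there x∈ys) (there y∈ys) y≢x = there (∈-─⁺ x∈ys y∈ys y≢x)

Unique-⊆⇒|xs|≤|ys| : {xs ys : List A} → Unique xs → xs ⊆ ys → length xs ≤ length ys
Unique-⊆⇒|xs|≤|ys| {xs = []}     _            _     = z≤n
Unique-⊆⇒|xs|≤|ys| {xs = x ∷ xs} {ys} (x∉xs ∷ xs!) xs⊆ys =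
  ℕ.≤-trans (s≤s (Unique-⊆⇒|xs|≤|ys| xs! xs⊆ys─x))
            (ℕ.≤-reflexive (sym (length-removeAt′ ys (index x∈ys))))
  where
  x∈ys = xs⊆ys (here refl)
  xs⊆ys─x : xs ⊆ (ys ─ x∈ys)
  xs⊆ys─x y∈xs = ∈-─⁺ x∈ys (xs⊆ys (there y∈xs)) (λ y≡x → All.lookup x∉xs y∈xs (sym y≡x))

length-deduplicate-map : (h : ℕ → ℕ) (xs : List ℕ) →
  length (deduplicate ℕ._≟_ (map h xs)) ≤ length (deduplicate ℕ._≟_ xs)
length-deduplicate-map h xs = ℕ.≤-trans
  (Unique-⊆⇒|xs|≤|ys| (deduplicate-! (map h xs)) image⊆)
  (ℕ.≤-reflexive (length-map h (deduplicate ℕ._≟_ xs)))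
  where
  image⊆ : deduplicate ℕ._≟_ (map h xs) ⊆ map h (deduplicate ℕ._≟_ xs)
  image⊆ z∈ with ∈-map⁻ h (∈-deduplicate⁻ ℕ._≟_ (map h xs) z∈)
  ... | x , x∈xs , refl = ∈-map⁺ h (∈-deduplicate⁺ ℕ._≟_ x∈xs)

FactorsThrough : (Fin m → ℕ) → (Fin m → ℕ) → Set
FactorsThrough ρ′ ρ = ∀ {s t} → ρ s ≡ ρ t → ρ′ s ≡ ρ′ t

FactorsThrough⇒numPiles≤ : (ρ ρ′ : Fin n → ℕ) → FactorsThrough ρ′ ρ → numPiles ρ′ ≤ numPiles ρ
FactorsThrough⇒numPiles≤ {n} ρ ρ′ factors =
  subst (λ xs → length (deduplicate ℕ._≟_ xs) ≤ numPiles ρ) h∘ρ≡ρ′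
    (length-deduplicate-map h (map ρ (allFin n)))
  where
  h : ℕ → ℕ
  h v with F.any? (λ s → ρ s ℕ.≟ v)
  ... | yes (s , _) = ρ′ s
  ... | no _        = 0
  h-ρ : ∀ t → h (ρ t) ≡ ρ′ t
  h-ρ t with F.any? (λ s → ρ s ℕ.≟ ρ t)
  ... | yes (s , ρs≡ρt) = factors ρs≡ρt
  ... | no ∄s           = contradiction (t , refl) ∄s
  h∘ρ≡ρ′ : map h (map ρ (allFin n)) ≡ map ρ′ (allFin n)
  h∘ρ≡ρ′ = trans (sym (map-∘ (allFin n))) (map-cong h-ρ (allFin n))

KeyIncreasing : (Fin m → Fin k) → (Fin m → ℕ) → Set
KeyIncreasing f ρ = ∀ {s t} → s F.< t → ρ s < ρ t ⊎ (ρ s ≡ ρ t × f t F.< f s)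

sortsOnStacks⇒keyIncreasing : (π : Permutation′ n) {ρ : Fin n → ℕ} →
  SortsOnStacks π ρ → KeyIncreasing (π ⟨$⟩ʳ_) ρ
sortsOnStacks⇒keyIncreasing π sorts {s} {t} = Equivalence.to (sorts s t)

-- The converse implication demanded by SortsOnStacks is free: the lexicographic key order
-- is asymmetric.
keyIncreasing⇒sortsOnStacks : (π : Permutation′ n) {ρ : Fin n → ℕ} →
  KeyIncreasing (π ⟨$⟩ʳ_) ρ → SortsOnStacks π ρ
keyIncreasing⇒sortsOnStacks π {ρ} increasing s t = mk⇔ increasing from
  where
  lex-asym : ∀ {s t} → LexKeyLt π ρ s t → ¬ LexKeyLt π ρ t s
  lex-asym {s} {t} =
    ×-asymmetric {_≈₁_ = _≡_} {_<₁_ = _<_} {_<₂_ = λ i j → j F.< i}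
      sym (subst (_ <_) , subst (_< _)) ℕ.<-asym ℕ.<-asym
      {ρ s , π ⟨$⟩ʳ s} {ρ t , π ⟨$⟩ʳ t}
  from : LexKeyLt π ρ s t → s F.< t
  from lt with F.<-cmp s t
  ... | tri< s<t _ _ = s<t
  ... | tri≈ _ refl _ = contradiction lt (lex-asym lt)
  ... | tri> _ _ t<s  = contradiction lt (lex-asym (increasing t<s))

KeyIncreasing-tail : {f : Fin (suc m) → Fin k} {ρ : Fin (suc m) → ℕ} →
  KeyIncreasing f ρ → KeyIncreasing (f ∘ suc) (ρ ∘ suc)
KeyIncreasing-tail increasing s<t = increasing (s≤s s<t)

KeyIncreasing⇒mono : {f : Fin m → Fin k} {ρ : Fin m → ℕ} →
  KeyIncreasing f ρ → ∀ {s t} → s F.≤ t → ρ s ≤ ρ t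
KeyIncreasing⇒mono increasing {s} {t} s≤t with F.<-cmp s t
... | tri≈ _ refl _ = ℕ.≤-refl
... | tri> _ _ t<s  = contradiction s≤t (ℕ.<⇒≱ t<s)
... | tri< s<t _ _ with increasing s<t
...   | inj₁ ρs<ρt       = ℕ.<⇒≤ ρs<ρt
...   | inj₂ (ρs≡ρt , _) = ℕ.≤-reflexive ρs≡ρt

ascent≡0⇒≥ : (a b : Fin k) → ascent a b ≡ 0 → b F.≤ a
ascent≡0⇒≥ a b e with toℕ a ℕ.<? toℕ b
... | no a≮b = ℕ.≮⇒≥ a≮b

>⇒ascent≡0 : (a b : Fin k) → b F.< a → ascent a b ≡ 0
>⇒ascent≡0 a b b<a with toℕ a ℕ.<? toℕ b
... | yes a<b = contradiction a<b (ℕ.<-asym b<a)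
... | no _    = refl

m+n≡1⇒m≡0 : ∀ m {n} → 0 < n → m + n ≡ 1 → m ≡ 0
m+n≡1⇒m≡0 zero    _   _ = refl
m+n≡1⇒m≡0 (suc m) 0<n e = contradiction (ℕ.m+n≡0⇒n≡0 m (ℕ.suc-injective e)) (ℕ.n>0⇒n≢0 0<n)

rhoStarFun-positive : (f : Fin m → Fin k) (s : Fin m) → 1 ≤ rhoStarFun f s
rhoStarFun-positive {suc m}       f zero    = s≤s z≤n
rhoStarFun-positive {suc (suc m)} f (suc s) =
  ℕ.≤-trans (rhoStarFun-positive (f ∘ suc) s) (ℕ.m≤n+m _ (ascent (f zero) (f (suc zero))))

rhoStarFun-mono : (f : Fin m → Fin k) {s t : Fin m} → s F.≤ t → rhoStarFun f s ≤ rhoStarFun f t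
rhoStarFun-mono {suc m}       f {zero}  {t}     _         = rhoStarFun-positive f t
rhoStarFun-mono {suc (suc m)} f {suc s} {suc t} (s≤s s≤t) =
  ℕ.+-monoʳ-≤ (ascent (f zero) (f (suc zero))) (rhoStarFun-mono (f ∘ suc) s≤t)

rhoStarFun-≡⇒descending : (f : Fin m → Fin k) {s t : Fin m} → s F.≤ t →
  rhoStarFun f s ≡ rhoStarFun f t → f t F.≤ f s
rhoStarFun-≡⇒descending {suc m} f {zero} {zero} _ _ = ℕ.≤-refl
rhoStarFun-≡⇒descending {suc (suc m)} f {zero} {suc t} _ 1≡a+r =
  ℕ.≤-trans (rhoStarFun-≡⇒descending (f ∘ suc) {zero} z≤n 1≡r)
            (ascent≡0⇒≥ (f zero) (f (suc zero)) a≡0)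
  where
  a = ascent (f zero) (f (suc zero))
  r = rhoStarFun (f ∘ suc) t
  a≡0 : a ≡ 0
  a≡0 = m+n≡1⇒m≡0 a (rhoStarFun-positive (f ∘ suc) t) (sym 1≡a+r)
  1≡r : 1 ≡ r
  1≡r = trans 1≡a+r (cong (_+ r) a≡0)
rhoStarFun-≡⇒descending {suc (suc m)} f {suc s} {suc t} (s≤s s≤t) e =
  rhoStarFun-≡⇒descending (f ∘ suc) s≤t (ℕ.+-cancelˡ-≡ (ascent (f zero) (f (suc zero))) _ _ e)

rhoStarFun-keyIncreasing : (f : Fin m → Fin k) → Injective _≡_ _≡_ f →
  KeyIncreasing f (rhoStarFun f)
rhoStarFun-keyIncreasing f f-injective {s} {t} s<t
  with ℕ.m≤n⇒m<n∨m≡n (rhoStarFun-mono f (ℕ.<⇒≤ s<t))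
... | inj₁ ρs<ρt = inj₁ ρs<ρt
... | inj₂ ρs≡ρt = inj₂ (ρs≡ρt , F.≤∧≢⇒< ft≤fs ft≢fs)
  where
  ft≤fs = rhoStarFun-≡⇒descending f (ℕ.<⇒≤ s<t) ρs≡ρt
  ft≢fs : f t ≢ f s
  ft≢fs ft≡fs = F.<-irrefl (f-injective (sym ft≡fs)) s<t

-- A sorting ρ cannot stay constant across an ascent of f, so on the first step of a fibre
-- of ρ the ascent indicator vanishes.
KeyIncreasing⇒rhoStarFun-≤-fibre : {f : Fin m → Fin k} {ρ : Fin m → ℕ} → KeyIncreasing f ρ →
  ∀ {s t} → s F.≤ t → ρ s ≡ ρ t → rhoStarFun f s ≡ rhoStarFun f t
KeyIncreasing⇒rhoStarFun-≤-fibre {suc m} _ {zero} {zero} _ _ = refl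
KeyIncreasing⇒rhoStarFun-≤-fibre {suc (suc m)} {f = f} {ρ} increasing {zero} {suc t} _ ρ₀≡ρt =
  trans 1≡r (cong (_+ r) (sym a≡0))
  where
  a = ascent (f zero) (f (suc zero))
  r = rhoStarFun (f ∘ suc) t
  ρ₀≡ρ₁ : ρ zero ≡ ρ (suc zero)
  ρ₀≡ρ₁ = ℕ.≤-antisym (KeyIncreasing⇒mono increasing {zero} {suc zero} z≤n)
    (ℕ.≤-trans (KeyIncreasing⇒mono increasing {suc zero} {suc t} (s≤s z≤n))
               (ℕ.≤-reflexive (sym ρ₀≡ρt)))
  a≡0 : a ≡ 0
  a≡0 with increasing {zero} {suc zero} (s≤s z≤n)
  ... | inj₁ ρ₀<ρ₁       = contradiction ρ₀≡ρ₁ (ℕ.<⇒≢ ρ₀<ρ₁)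
  ... | inj₂ (_ , f₁<f₀) = >⇒ascent≡0 (f zero) (f (suc zero)) f₁<f₀
  1≡r : 1 ≡ r
  1≡r = KeyIncreasing⇒rhoStarFun-≤-fibre (KeyIncreasing-tail increasing) {zero} {t} z≤n
          (trans (sym ρ₀≡ρ₁) ρ₀≡ρt)
KeyIncreasing⇒rhoStarFun-≤-fibre {suc (suc m)} {f = f} increasing {suc s} {suc t} (s≤s s≤t) ρs≡ρt =
  cong (ascent (f zero) (f (suc zero)) +_)
    (KeyIncreasing⇒rhoStarFun-≤-fibre (KeyIncreasing-tail increasing) s≤t ρs≡ρt)

KeyIncreasing⇒rhoStarFun-factorsThrough : {f : Fin m → Fin k} {ρ : Fin m → ℕ} →
  KeyIncreasing f ρ → FactorsThrough (rhoStarFun f) ρ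
KeyIncreasing⇒rhoStarFun-factorsThrough increasing {s} {t} ρs≡ρt with F.≤-total s t
... | inj₁ s≤t = KeyIncreasing⇒rhoStarFun-≤-fibre increasing s≤t ρs≡ρt
... | inj₂ t≤s = sym (KeyIncreasing⇒rhoStarFun-≤-fibre increasing t≤s (sym ρs≡ρt))

lemma6 : ∀ (n : ℕ) (π : Permutation′ n) →
    SortsOnStacks π (rhoStar π) ×
    (∀ (ρ : Fin n → ℕ) → SortsOnStacks π ρ → numPiles (rhoStar π) ≤ numPiles ρ)
lemma6 n π =
  keyIncreasing⇒sortsOnStacks π
    (rhoStarFun-keyIncreasing (π ⟨$⟩ʳ_) (Injection.injective (↔⇒↣ π))) ,
  λ ρ sorts → FactorsThrough⇒numPiles≤ ρ (rhoStar π)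
    (KeyIncreasing⇒rhoStarFun-factorsThrough (sortsOnStacks⇒keyIncreasing π sorts))
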